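{- Let $t\ge 2$ and let $m_2,m_3,\ldots,m_t$ be positive integers with $n=m_2+\cdots+m_t\ge t$. Let $$\alpha=(\underbrace{t,\ldots,t}_{m_t},\underbrace{t-1,\ldots,t-1}_{m_{t-1}},\ldots,\underbrace{3,\ldots,3}_{m_3},\underbrace{2,\ldots,2}_{m_2})\in\{1,\ldots,n\}^n.$$ Then $$g(\alpha)=2^{n-1}-2^{n-m_2}+2^{n-m_2-1}-2^{n-m_2-m_3}+2^{n-m_2-m_3-1}-\cdots+2^{m_t-1}-1,$$ that is, writing $R_j=n-(m_2+\cdots+m_j)$ for $1\le j\le t$ (so $R_1=n$, $R_{t-1}=m_t$, $R_t=0$), $g(\alpha)=\sum_{j=1}^{t-1}\bigl(2^{R_j-1}-2^{R_{j+1}}\bigr)$.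
   Context: Parking spots $1,\ldots,n$ in a line; cars $C_1,\ldots,C_n$ arrive in order, $C_i$ preferring spot $\alpha_i$. Given $\beta=(\beta_2,\ldots,\beta_n)\in\{0,1\}^{n-1}$: $C_i$ parks at $\alpha_i$ if it is empty; if $\alpha_i$ is occupied and $\beta_i=1$, $C_i$ parks in the first empty spot among $\alpha_i+1,\ldots,n$; if $\alpha_i$ is occupied and $\beta_i=0$, $C_i$ parks at $\alpha_i-1$ if $\alpha_i\ge2$ and it is empty, and otherwise in the first empty spot among $\alpha_i+1,\ldots,n$. A car finding no empty spot fails. $g(\alpha)$ is the number of $\beta\in\{0,1\}^{n-1}$ for which every car parks (so $g(\alpha)/2^{n-1}$ is the probability that $\alpha$ parks in the random $1$-Naples model with $p=1/2$). -}

module Defs where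

open import Data.Nat using (ℕ; zero; suc; _+_; _∸_; _^_)
open import Data.Bool using (Bool; true; false; not; if_then_else_)
open import Data.List using (List; []; _∷_; _++_; replicate; map)
open import Data.Maybe using (Maybe; just; nothing)
open import Data.Integer as ℤ using (ℤ)

-- Parking lot state: a list of length n; entry i (0-based) is spot i+1;
-- true = occupied.

emptyAt0 : List Bool → ℕ → Bool
emptyAt0 []       _       = false
emptyAt0 (o ∷ os) zero    = not o
emptyAt0 (o ∷ os) (suc k) = emptyAt0 os k

-- Is (1-based) spot k empty? Spot 0 does not exist.
emptyAt : List Bool → ℕ → Bool
emptyAt os zero    = false
emptyAt os (suc k) = emptyAt0 os k

fill0 : List Bool → ℕ → List Bool
fill0 []       _       = []
fill0 (o ∷ os) zero    = true ∷ os
fill0 (o ∷ os) (suc k) = o ∷ fill0 os k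

fill : List Bool → ℕ → List Bool
fill os zero    = os
fill os (suc k) = fill0 os k

firstEmptyFuel : List Bool → ℕ → ℕ → Maybe ℕ
firstEmptyFuel os k zero    = nothing
firstEmptyFuel os k (suc f) =
  if emptyAt os k then just k else firstEmptyFuel os (suc k) f

firstEmptyFrom : ℕ → List Bool → ℕ → Maybe ℕ
firstEmptyFrom n os k = firstEmptyFuel os k (suc n)

parkOne : ℕ → List Bool → ℕ → Bool → Maybe ℕ
parkOne n os a b =
  if emptyAt os a then just a
  else if b then firstEmptyFrom n os (suc a)
  else if emptyAt os (a ∸ 1) then just (a ∸ 1)   -- emptyAt os 0 = false covers a = 1
  else firstEmptyFrom n os (suc a)

runCars : ℕ → List Bool → List ℕ → List Bool → Bool
runCars n os []       []       = true
runCars n os (a ∷ as) (b ∷ bs) with parkOne n os a b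
... | just k  = runCars n (fill os k) as bs
... | nothing = false
runCars n os _        _        = false

-- α parks under β = (β₂,…,βₙ). Car 1 meets an empty lot, so its bit is
-- irrelevant (we feed `true`).
parks : ℕ → List ℕ → List Bool → Bool
parks n []       β = true
parks n (a ∷ as) β = runCars n (replicate n false) (a ∷ as) (true ∷ β)

allBools : ℕ → List (List Bool)
allBools zero    = [] ∷ []
allBools (suc k) = map (true ∷_) (allBools k) ++ map (false ∷_) (allBools k)

count : {A : Set} → (A → Bool) → List A → ℕ
count f []       = 0
count f (x ∷ xs) = if f x then suc (count f xs) else count f xs

g : ℕ → List ℕ → ℕ
g n α = count (parks n α) (allBools (n ∸ 1))

pre : (ℕ → ℕ) → ℕ → ℕ
pre m zero          = 0
pre m (suc zero)    = 0
pre m (suc (suc k)) = pre m (suc k) + m (suc (suc k))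

blocks : (ℕ → ℕ) → ℕ → List ℕ
blocks m zero          = []
blocks m (suc zero)    = []
blocks m (suc (suc k)) = replicate (m (suc (suc k))) (suc (suc k)) ++ blocks m (suc k)

sumFrom1 : ℕ → (ℕ → ℤ) → ℤ
sumFrom1 zero    f = ℤ.+ 0
sumFrom1 (suc k) f = sumFrom1 k f ℤ.+ f (suc k)

module Submission where

-- The cars arrive in blocks of decreasing preference and the occupied spots always form a single
-- run, so the lot is `lot a b c`: a free spots, a run of b, then c free spots. When the block of
-- preference q arrives, spot q either starts the run or lies just before it. In the first case
-- a car with bit 1 runs forward past the run, while a car with bit 0 takes spot q - 1, after which
-- every later car of the block is pushed forward whatever its bit; in the second case the first
-- car simply takes spot q and the rest of the block proceeds as in the first case. Writing h_q for
-- the closed form with t replaced by q, so that h_q + 1 = 2^(m_q - 1) (2 h_{q-1} + 1), induction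
-- on q shows that the remaining cars park for 2 h_q + 1 bit strings in the first case and for
-- 2 h_q in the second. The first car finds spot t free, and its bit is fixed, so g(α) = h_t.

open import Defs
open import Algebra.Properties.CommutativeSemigroup using (xy∙z≈y∙xz)
open import Data.Bool using (Bool; true; false; not)
open import Data.Integer as ℤ using (ℤ; +_; _-_)
import Data.Integer.Properties as ℤ
import Data.Integer.Tactic.RingSolver as ℤ-Solver
open import Data.List using (List; []; _∷_; _++_; replicate; length; map)
open import Data.List.Properties using (length-++; length-replicate)
open import Data.Maybe using (just; nothing; maybe′)
open import Data.Nat using (ℕ; zero; suc; _+_; _*_; _∸_; _^_; _≤_; _<_; z≤n; s≤s)
open import Data.Nat.Properties
import Data.Nat.Tactic.RingSolver as ℕ-Solver
open import Data.Product using (∃-syntax; _,_; _×_; proj₁; proj₂)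
open import Data.Sum using (inj₁; inj₂)
open import Function using (_∘_)
open import Relation.Binary.PropositionalEquality
open import Relation.Nullary using (contradiction)

-- The `emptyAt0` lemmas index spots from 0, whereas `parkOne` and `fill` index them from 1.
lot : ℕ → ℕ → ℕ → List Bool
lot a b c = replicate a false ++ replicate b true ++ replicate c false

replicate-lot : ∀ a c → replicate (a + c) false ≡ lot a 0 c
replicate-lot zero    c = refl
replicate-lot (suc a) c = cong (false ∷_) (replicate-lot a c)

emptyAt0-replicate-< : ∀ a x L k → k < a → emptyAt0 (replicate a x ++ L) k ≡ not x
emptyAt0-replicate-< (suc a) x L zero    _         = refl
emptyAt0-replicate-< (suc a) x L (suc k) (s≤s k<a) = emptyAt0-replicate-< a x L k k<a

emptyAt0-replicate-+ : ∀ a x L k → emptyAt0 (replicate a x ++ L) (a + k) ≡ emptyAt0 L k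
emptyAt0-replicate-+ zero    x L k = refl
emptyAt0-replicate-+ (suc a) x L k = emptyAt0-replicate-+ a x L k

fill0-replicate-+ : ∀ a x L k → fill0 (replicate a x ++ L) (a + k) ≡ replicate a x ++ fill0 L k
fill0-replicate-+ zero    x L k = refl
fill0-replicate-+ (suc a) x L k = cong (x ∷_) (fill0-replicate-+ a x L k)

lot-left : ∀ a b c k → k < a → emptyAt0 (lot a b c) k ≡ true
lot-left a b c = emptyAt0-replicate-< a false _

lot-run : ∀ a b c k → k < b → emptyAt0 (lot a b c) (a + k) ≡ false
lot-run a b c k k<b = trans (emptyAt0-replicate-+ a false _ k) (emptyAt0-replicate-< b true _ k k<b)

lot-right : ∀ a b c → emptyAt0 (lot a b (suc c)) (a + b) ≡ true
lot-right a b c = trans (emptyAt0-replicate-+ a false _ b)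
  (subst (λ k → emptyAt0 (replicate b true ++ replicate (suc c) false) k ≡ true) (+-identityʳ b)
         (emptyAt0-replicate-+ b true _ 0))

lot-full : ∀ a b k → emptyAt0 (lot a b 0) (a + k) ≡ false
lot-full a b k = trans (emptyAt0-replicate-+ a false _ k) (all-occupied b k)
  where
  all-occupied : ∀ b k → emptyAt0 (replicate b true ++ []) k ≡ false
  all-occupied zero    k       = refl
  all-occupied (suc b) zero    = refl
  all-occupied (suc b) (suc k) = all-occupied b k

firstEmptyFuel-after : ∀ os k d f → (∀ i → i < d → emptyAt os (k + i) ≡ false) →
  emptyAt os (k + d) ≡ true → firstEmptyFuel os k (suc (d + f)) ≡ just (k + d)
firstEmptyFuel-after os k zero f _ empty rewrite +-identityʳ k | empty = refl
firstEmptyFuel-after os k (suc d) f occupied empty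
  rewrite subst (λ s → emptyAt os s ≡ false) (+-identityʳ k) (occupied 0 (s≤s z≤n)) =
  trans (firstEmptyFuel-after os (suc k) d f occupied′ (subst (λ s → emptyAt os s ≡ true) (+-suc k d) empty))
        (cong just (sym (+-suc k d)))
  where
  occupied′ : ∀ i → i < d → emptyAt os (suc k + i) ≡ false
  occupied′ i i<d = subst (λ s → emptyAt os s ≡ false) (+-suc k i) (occupied (suc i) (s≤s i<d))

firstEmptyFuel-none : ∀ os k f → (∀ i → emptyAt os (k + i) ≡ false) → firstEmptyFuel os k f ≡ nothing
firstEmptyFuel-none os k zero    _ = refl
firstEmptyFuel-none os k (suc f) occupied
  rewrite subst (λ s → emptyAt os s ≡ false) (+-identityʳ k) (occupied 0) =
  firstEmptyFuel-none os (suc k) f λ i → subst (λ s → emptyAt os s ≡ false) (+-suc k i) (occupied (suc i))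

firstEmptyFrom-lot : ∀ n a b c e → b ≤ n →
  firstEmptyFrom n (lot a (e + b) (suc c)) (suc (e + a)) ≡ just (suc (a + (e + b)))
firstEmptyFrom-lot n a b c e b≤n = begin
  firstEmptyFuel os (suc (e + a)) (suc n)
    ≡⟨ cong (λ f → firstEmptyFuel os (suc (e + a)) (suc f)) (sym (m+[n∸m]≡n b≤n)) ⟩
  firstEmptyFuel os (suc (e + a)) (suc (b + (n ∸ b)))
    ≡⟨ firstEmptyFuel-after os (suc (e + a)) b (n ∸ b) run right ⟩
  just (suc (e + a + b))
    ≡⟨ cong (λ k → just (suc k)) (shift b) ⟩
  just (suc (a + (e + b))) ∎
  where
  open ≡-Reasoning
  os = lot a (e + b) (suc c)
  shift : ∀ i → e + a + i ≡ a + (e + i)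
  shift = xy∙z≈y∙xz +-commutativeSemigroup e a
  run : ∀ i → i < b → emptyAt0 os (e + a + i) ≡ false
  run i i<b = subst (λ k → emptyAt0 os k ≡ false) (sym (shift i))
                    (lot-run a (e + b) (suc c) (e + i) (+-monoʳ-< e i<b))
  right : emptyAt0 os (e + a + b) ≡ true
  right = subst (λ k → emptyAt0 os k ≡ true) (sym (shift b)) (lot-right a (e + b) c)

firstEmptyFrom-full : ∀ n a b e → firstEmptyFrom n (lot a b 0) (suc (e + a)) ≡ nothing
firstEmptyFrom-full n a b e = firstEmptyFuel-none (lot a b 0) (suc (e + a)) (suc n) λ i →
  subst (λ k → emptyAt0 (lot a b 0) k ≡ false) (sym (xy∙z≈y∙xz +-commutativeSemigroup e a i))
        (lot-full a b (e + i))

lot-run-start : ∀ a b c → emptyAt0 (lot a (suc b) c) a ≡ false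
lot-run-start a b c = subst (λ k → emptyAt0 (lot a (suc b) c) k ≡ false) (+-identityʳ a)
                            (lot-run a (suc b) c 0 (s≤s z≤n))

lot-run-second : ∀ a b c → emptyAt0 (lot a (2 + b) c) (suc a) ≡ false
lot-run-second a b c = subst (λ k → emptyAt0 (lot a (2 + b) c) k ≡ false) (+-comm a 1)
                              (lot-run a (2 + b) c 1 (s≤s (s≤s z≤n)))

module _ (n : ℕ) where

  parkOne-gap : ∀ a b c x → parkOne n (lot (suc a) b c) (suc a) x ≡ just (suc a)
  parkOne-gap a b c x rewrite lot-left (suc a) b c a ≤-refl = refl

  parkOne-left : ∀ a b c → parkOne n (lot (suc a) (suc b) c) (2 + a) false ≡ just (suc a)
  parkOne-left a b c rewrite lot-run-start (suc a) b c | lot-left (suc a) (suc b) c a ≤-refl = refl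

  parkOne-forward : ∀ a b c → b ≤ n →
    parkOne n (lot (suc a) (suc b) (suc c)) (2 + a) true ≡ just (suc (suc a + suc b))
  parkOne-forward a b c b≤n rewrite lot-run-start (suc a) b (suc c) = firstEmptyFrom-lot n (suc a) b c 1 b≤n

  parkOne-overflow : ∀ a b → parkOne n (lot (suc a) (suc b) 0) (2 + a) true ≡ nothing
  parkOne-overflow a b rewrite lot-run-start (suc a) b 0 = firstEmptyFrom-full n (suc a) (suc b) 1

  parkOne-blocked : ∀ a b c x → b ≤ n →
    parkOne n (lot a (2 + b) (suc c)) (2 + a) x ≡ just (suc (a + (2 + b)))
  parkOne-blocked a b c x b≤n rewrite lot-run-second a b (suc c) with x
  ... | true = firstEmptyFrom-lot n a b c 2 b≤n
  ... | false rewrite lot-run-start a (suc b) (suc c) = firstEmptyFrom-lot n a b c 2 b≤n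

fill-gap : ∀ a b c → fill (lot (suc a) b c) (suc a) ≡ lot a (suc b) c
fill-gap zero    b c = refl
fill-gap (suc a) b c = cong (false ∷_) (fill-gap a b c)

fill-right : ∀ a b c → fill (lot a b (suc c)) (suc (a + b)) ≡ lot a (suc b) c
fill-right a b c = trans (fill0-replicate-+ a false _ b) (cong (replicate a false ++_) (fill0-end b))
  where
  fill0-end : ∀ b →
    fill0 (replicate b true ++ replicate (suc c) false) b ≡ replicate (suc b) true ++ replicate c false
  fill0-end zero    = refl
  fill0-end (suc b) = cong (true ∷_) (fill0-end b)

count-++ : ∀ {A : Set} (f : A → Bool) xs ys → count f (xs ++ ys) ≡ count f xs + count f ys
count-++ f []       ys = refl
count-++ f (x ∷ xs) ys with f x
... | true  = cong suc (count-++ f xs ys)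
... | false = count-++ f xs ys

count-map : ∀ {A B : Set} (f : B → Bool) (h : A → B) xs → count f (map h xs) ≡ count (f ∘ h) xs
count-map f h []       = refl
count-map f h (x ∷ xs) with f (h x)
... | true  = cong suc (count-map f h xs)
... | false = count-map f h xs

count-false : ∀ {A : Set} (xs : List A) → count (λ _ → false) xs ≡ 0
count-false []       = refl
count-false (x ∷ xs) = count-false xs

count-allBools-suc : ∀ (f : List Bool → Bool) k →
  count f (allBools (suc k)) ≡ count (f ∘ (true ∷_)) (allBools k) + count (f ∘ (false ∷_)) (allBools k)
count-allBools-suc f k = trans (count-++ f (map (true ∷_) (allBools k)) _)
  (cong₂ _+_ (count-map f (true ∷_) (allBools k)) (count-map f (false ∷_) (allBools k)))

module _ (n : ℕ) where

  ways : List Bool → List ℕ → ℕ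
  ways os cs = count (runCars n os cs) (allBools (length cs))

  afterPark : List Bool → ℕ → List ℕ → Bool → ℕ
  afterPark os p ps x = maybe′ (λ k → ways (fill os k) ps) 0 (parkOne n os p x)

  count-runCars-∷ : ∀ os p ps x bss →
    count (λ bs → runCars n os (p ∷ ps) (x ∷ bs)) bss ≡
    maybe′ (λ k → count (runCars n (fill os k) ps) bss) 0 (parkOne n os p x)
  count-runCars-∷ os p ps x bss with parkOne n os p x
  ... | just k  = refl
  ... | nothing = count-false bss

  ways-∷ : ∀ os p ps → ways os (p ∷ ps) ≡ afterPark os p ps true + afterPark os p ps false
  ways-∷ os p ps = trans (count-allBools-suc (runCars n os (p ∷ ps)) (length ps))
    (cong₂ _+_ (count-runCars-∷ os p ps true (allBools (length ps)))
               (count-runCars-∷ os p ps false (allBools (length ps))))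

  g-∷ : ∀ p ps → n ∸ 1 ≡ length ps → g n (p ∷ ps) ≡ afterPark (replicate n false) p ps true
  g-∷ p ps n∸1≡len =
    trans (cong (λ L → count (λ β → runCars n (replicate n false) (p ∷ ps) (true ∷ β)) (allBools L))
                n∸1≡len)
          (count-runCars-∷ (replicate n false) p ps true (allBools (length ps)))

  afterPark-moves : ∀ os p ps x {k os′} → parkOne n os p x ≡ just k → fill os k ≡ os′ →
    afterPark os p ps x ≡ ways os′ ps
  afterPark-moves os p ps x parks refl = cong (maybe′ (λ k → ways (fill os k) ps) 0) parks

  afterPark-fails : ∀ os p ps x → parkOne n os p x ≡ nothing → afterPark os p ps x ≡ 0
  afterPark-fails os p ps x fails = cong (maybe′ (λ k → ways (fill os k) ps) 0) fails

  ways-blocked : ∀ k a b c d rs → k + d ≡ c → b + c ≤ n →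
    ways (lot a (2 + b) c) (replicate k (2 + a) ++ rs) ≡ 2 ^ k * ways (lot a (2 + (k + b)) d) rs
  ways-blocked zero    a b c .c rs refl fits = sym (*-identityˡ _)
  ways-blocked (suc k) a b .(suc (k + d)) d rs refl fits = begin
    ways os (2 + a ∷ cs)                          ≡⟨ ways-∷ os (2 + a) cs ⟩
    afterPark os (2 + a) cs true + afterPark os (2 + a) cs false
      ≡⟨ cong₂ _+_ (forward true) (forward false) ⟩
    W + W                                          ≡⟨ cong (λ w → w + w) IH ⟩
    2 ^ k * X + 2 ^ k * X                          ≡⟨ double (2 ^ k) X ⟩
    2 ^ suc k * X
      ≡⟨ cong (λ B → 2 ^ suc k * ways (lot a (2 + B) d) rs) (+-suc k b) ⟩
    2 ^ suc k * ways (lot a (2 + (suc k + b)) d) rs ∎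
    where
    open ≡-Reasoning
    os = lot a (2 + b) (suc (k + d))
    cs = replicate k (2 + a) ++ rs
    W = ways (lot a (3 + b) (k + d)) cs
    X = ways (lot a (2 + (k + suc b)) d) rs
    forward : ∀ x → afterPark os (2 + a) cs x ≡ W
    forward x = afterPark-moves os (2 + a) cs x (parkOne-blocked n a b (k + d) x (≤-trans (m≤m+n b _) fits))
                                (fill-right a (2 + b) (k + d))
    IH : W ≡ 2 ^ k * X
    IH = ways-blocked k a (suc b) (k + d) d rs refl (subst (_≤ n) (+-suc b (k + d)) fits)
    double : ∀ p x → p * x + p * x ≡ (2 * p) * x
    double = ℕ-Solver.solve-∀

  -- After a whole block has run forward the right gap has e - 1 spots left; e = 0 means that
  -- its last car found no room.
  waysIfRoom : ℕ → ℕ → ℕ → List ℕ → ℕ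
  waysIfRoom a b zero    rs = 0
  waysIfRoom a b (suc e) rs = ways (lot a b e) rs

  ways-block : ∀ k a b c e rs → k + e ≡ suc c → b + c ≤ n →
    ways (lot (suc a) (suc b) c) (replicate k (2 + a) ++ rs) + ways (lot a (suc (k + b)) e) rs
    ≡ 2 ^ k * ways (lot a (suc (k + b)) e) rs + waysIfRoom (suc a) (suc (k + b)) e rs
  ways-block zero a b c .(suc c) rs refl fits =
    trans (+-comm (ways (lot (suc a) (suc b) c) rs) L) (cong (_+ ways (lot (suc a) (suc b) c) rs) (sym (*-identityˡ L)))
    where L = ways (lot a (suc b) (suc c)) rs
  ways-block (suc zero) a b zero zero rs refl fits = trans (cong (_+ L) (trans (ways-∷ os (2 + a) rs) (cong₂ _+_
      (afterPark-fails os (2 + a) rs true (parkOne-overflow n a b))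
      (afterPark-moves os (2 + a) rs false (parkOne-left n a b 0) (fill-gap a (suc b) 0)))))
    (double L)
    where
    os = lot (suc a) (suc b) 0
    L = ways (lot a (2 + b) 0) rs
    double : ∀ l → 0 + l + l ≡ 2 * l + 0
    double = ℕ-Solver.solve-∀
  ways-block (suc (suc k)) a b zero e rs () fits
  ways-block (suc zero) a b zero (suc e) rs () fits
  ways-block (suc k) a b (suc c) e rs k+e≡ fits = begin
    ways os (2 + a ∷ cs) + L                       ≡⟨ cong (_+ L) (ways-∷ os (2 + a) cs) ⟩
    afterPark os (2 + a) cs true + afterPark os (2 + a) cs false + L
      ≡⟨ cong (_+ L) (cong₂ _+_ goForward goLeft) ⟩
    T + 2 ^ k * L + L                              ≡⟨ regroup T (2 ^ k * L) L ⟩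
    (T + L) + 2 ^ k * L                            ≡⟨ cong (_+ 2 ^ k * L) IH ⟩
    2 ^ k * L + F + 2 ^ k * L                      ≡⟨ collect (2 ^ k) L F ⟩
    2 ^ suc k * L + F                              ∎
    where
    open ≡-Reasoning
    os = lot (suc a) (suc b) (suc c)
    cs = replicate k (2 + a) ++ rs
    L = ways (lot a (2 + (k + b)) e) rs
    F = waysIfRoom (suc a) (2 + (k + b)) e rs
    T = ways (lot (suc a) (2 + b) c) cs
    goForward : afterPark os (2 + a) cs true ≡ T
    goForward = afterPark-moves os (2 + a) cs true (parkOne-forward n a b c (≤-trans (m≤m+n b _) fits))
                                (fill-right (suc a) (suc b) c)
    goLeft : afterPark os (2 + a) cs false ≡ 2 ^ k * L
    goLeft = trans (afterPark-moves os (2 + a) cs false (parkOne-left n a b (suc c)) (fill-gap a (suc b) (suc c)))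
                   (ways-blocked k a b (suc c) e rs (suc-injective k+e≡) fits)
    IH : T + L ≡ 2 ^ k * L + F
    IH = subst (λ B → T + ways (lot a (suc B) e) rs
                       ≡ 2 ^ k * ways (lot a (suc B) e) rs + waysIfRoom (suc a) (suc B) e rs)
               (+-suc k b) (ways-block k a (suc b) c e rs (suc-injective k+e≡) (subst (_≤ n) (+-suc b c) fits))
    regroup : ∀ t y l → t + y + l ≡ (t + l) + y
    regroup = ℕ-Solver.solve-∀
    collect : ∀ p l f → p * l + f + p * l ≡ (2 * p) * l + f
    collect = ℕ-Solver.solve-∀

BlocksNonempty : (ℕ → ℕ) → ℕ → Set
BlocksNonempty m t = ∀ j → 2 ≤ j → j ≤ t → 1 ≤ m j

module _ {m : ℕ → ℕ} where

  nonempty-pred : ∀ {t} → BlocksNonempty m (suc t) → BlocksNonempty m t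
  nonempty-pred {t} nonempty j 2≤j j≤t = nonempty j 2≤j (≤-trans j≤t (n≤1+n t))

  top-block : ∀ i → BlocksNonempty m (2 + i) → ∃[ k ] m (2 + i) ≡ suc k
  top-block i nonempty =
    let k , 1+k≡ = m≤n⇒∃[o]m+o≡n (nonempty (2 + i) (s≤s (s≤s z≤n)) ≤-refl) in k , sym 1+k≡

  blocks-top : ∀ i {k} → m (2 + i) ≡ suc k → blocks m (2 + i) ≡ 2 + i ∷ replicate k (2 + i) ++ blocks m (suc i)
  blocks-top i M≡ = cong (λ M → replicate M (2 + i) ++ blocks m (suc i)) M≡

  length-blocks : ∀ j → length (blocks m j) ≡ pre m j
  length-blocks zero          = refl
  length-blocks (suc zero)    = refl
  length-blocks (suc (suc j)) = begin
    length (replicate (m (2 + j)) (2 + j) ++ blocks m (suc j)) ≡⟨ length-++ (replicate (m (2 + j)) (2 + j)) ⟩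
    length (replicate (m (2 + j)) (2 + j)) + length (blocks m (suc j))
      ≡⟨ cong₂ _+_ (length-replicate (m (2 + j))) (length-blocks (suc j)) ⟩
    m (2 + j) + pre m (suc j)                                    ≡⟨ +-comm (m (2 + j)) _ ⟩
    pre m (2 + j)                                                ∎
    where open ≡-Reasoning

  g-blocks : ∀ i {k} → m (2 + i) ≡ suc k → 2 + i ≤ pre m (2 + i) →
    let n = pre m (2 + i) in
    g n (blocks m (2 + i)) ≡ ways n (lot (suc i) 1 (n ∸ (2 + i))) (replicate k (2 + i) ++ blocks m (suc i))
  g-blocks i {k} M≡ t≤n = begin
    g n (blocks m t)                        ≡⟨ cong (g n) (blocks-top i M≡) ⟩
    g n (t ∷ cs)                            ≡⟨ g-∷ n t cs n∸1≡ ⟩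
    afterPark n (replicate n false) t cs true ≡⟨ cong (λ os → afterPark n os t cs true) empty-lot ⟩
    afterPark n (lot t 0 c) t cs true
      ≡⟨ afterPark-moves n (lot t 0 c) t cs true (parkOne-gap n (suc i) 0 c true) (fill-gap (suc i) 0 c) ⟩
    ways n (lot (suc i) 1 c) cs             ∎
    where
    open ≡-Reasoning
    t = 2 + i
    n = pre m t
    c = n ∸ t
    cs = replicate k t ++ blocks m (suc i)
    n∸1≡ : n ∸ 1 ≡ length cs
    n∸1≡ = cong (_∸ 1) (trans (sym (length-blocks t)) (cong length (blocks-top i M≡)))
    empty-lot : replicate n false ≡ lot t 0 c
    empty-lot = trans (cong (λ s → replicate s false) (sym (m+[n∸m]≡n t≤n))) (replicate-lot t c)

  pre-mono : ∀ {j k} → j ≤ k → pre m j ≤ pre m k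
  pre-mono {j} {zero}  z≤n = ≤-refl
  pre-mono {j} {suc k} j≤1+k with m≤n⇒m<n∨m≡n j≤1+k
  ... | inj₂ refl      = ≤-refl
  ... | inj₁ (s≤s j≤k) = ≤-trans (pre-mono j≤k) (pre-step k)
    where
    pre-step : ∀ k → pre m k ≤ pre m (suc k)
    pre-step zero    = z≤n
    pre-step (suc k) = m≤m+n (pre m (suc k)) (m (2 + k))

  pre-< : ∀ {i j} → BlocksNonempty m (suc i) → 1 ≤ j → j ≤ i → pre m j < pre m (suc i)
  pre-< {zero}  {suc j} nonempty 1≤j ()
  pre-< {suc i} {j} nonempty 1≤j j≤1+i = begin-strict
    pre m j                 ≤⟨ pre-mono j≤1+i ⟩
    pre m (suc i)           <⟨ m<m+n (pre m (suc i)) (nonempty (2 + i) (s≤s (s≤s z≤n)) ≤-refl) ⟩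
    pre m (suc i) + m (2 + i) ∎
    where open ≤-Reasoning

  pre-≥ : ∀ i → BlocksNonempty m (suc i) → i ≤ pre m (suc i)
  pre-≥ zero    nonempty = z≤n
  pre-≥ (suc i) nonempty = subst (_≤ pre m (suc i) + m (2 + i)) (+-comm i 1)
    (+-mono-≤ (pre-≥ i (nonempty-pred nonempty)) (nonempty (2 + i) (s≤s (s≤s z≤n)) ≤-refl))

sumFrom1-scale : ∀ i (f h : ℕ → ℤ) c → (∀ j → 1 ≤ j → j ≤ i → f j ≡ c ℤ.* h j) →
  sumFrom1 i f ≡ c ℤ.* sumFrom1 i h
sumFrom1-scale zero    f h c f≡ch = sym (ℤ.*-zeroʳ c)
sumFrom1-scale (suc i) f h c f≡ch = begin
  sumFrom1 i f ℤ.+ f (suc i)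
    ≡⟨ cong₂ ℤ._+_ (sumFrom1-scale i f h c below) (f≡ch (suc i) (s≤s z≤n) ≤-refl) ⟩
  c ℤ.* sumFrom1 i h ℤ.+ c ℤ.* h (suc i)       ≡⟨ sym (ℤ.*-distribˡ-+ c (sumFrom1 i h) (h (suc i))) ⟩
  c ℤ.* (sumFrom1 i h ℤ.+ h (suc i))           ∎
  where
  open ≡-Reasoning
  below : ∀ j → 1 ≤ j → j ≤ i → f j ≡ c ℤ.* h j
  below j 1≤j j≤i = f≡ch j 1≤j (≤-trans j≤i (n≤1+n i))

tight-sum : ∀ {p q i} → i ≤ p → 1 ≤ q → p + q ≡ suc i → p ≡ i × q ≡ 1
tight-sum {p} {q} {i} i≤p 1≤q p+q≡ =
  p≡i , +-cancelˡ-≡ i q 1 (trans (cong (_+ q) (sym p≡i)) (trans p+q≡ (+-comm 1 i)))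
  where
  p≡i : p ≡ i
  p≡i = ≤-antisym (≤-pred (subst (suc p ≤_) p+q≡ (subst (_≤ p + q) (+-comm p 1) (+-monoʳ-≤ p 1≤q)))) i≤p

closedForm : (ℕ → ℕ) → ℕ → ℤ
closedForm m q = sumFrom1 (q ∸ 1) (λ j → + (2 ^ ((pre m q ∸ pre m j) ∸ 1)) - + (2 ^ (pre m q ∸ pre m (suc j))))

2^-shift : ∀ M x y → y ≤ x → 2 ^ (x + M ∸ y) ≡ 2 ^ M * 2 ^ (x ∸ y)
2^-shift M x y y≤x = trans (cong (2 ^_) (trans (+-∸-comm M y≤x) (+-comm (x ∸ y) M))) (^-distribˡ-+-* 2 M (x ∸ y))

term-scale : ∀ Q M p p′ → p < Q → p′ ≤ Q →
  + (2 ^ ((Q + M ∸ p) ∸ 1)) - + (2 ^ (Q + M ∸ p′))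
  ≡ + (2 ^ M) ℤ.* (+ (2 ^ ((Q ∸ p) ∸ 1)) - + (2 ^ (Q ∸ p′)))
term-scale Q M p p′ p<Q p′≤Q
  rewrite ∸-+-assoc (Q + M) p 1 | ∸-+-assoc Q p 1
        | 2^-shift M Q (p + 1) (subst (_≤ Q) (+-comm 1 p) p<Q) | 2^-shift M Q p′ p′≤Q
        | ℤ.pos-* (2 ^ M) (2 ^ (Q ∸ (p + 1))) | ℤ.pos-* (2 ^ M) (2 ^ (Q ∸ p′))
  = distrib (+ (2 ^ M)) (+ (2 ^ (Q ∸ (p + 1)))) (+ (2 ^ (Q ∸ p′)))
  where
  distrib : ∀ a b c → a ℤ.* b - a ℤ.* c ≡ a ℤ.* (b - c)
  distrib = ℤ-Solver.solve-∀

module _ {m : ℕ → ℕ} where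

  closedForm-step : ∀ i {k} → BlocksNonempty m (suc i) → m (2 + i) ≡ suc k →
    closedForm m (2 + i) ≡ + (2 ^ k) ℤ.* (+ 2 ℤ.* closedForm m (suc i) ℤ.+ + 1) - + 1
  closedForm-step i {k} nonempty M≡ = begin
    sumFrom1 i F₂ ℤ.+ F₂ (suc i)
      ≡⟨ cong₂ ℤ._+_ (sumFrom1-scale i F₂ F₁ (+ (2 ^ M)) scaled) last ⟩
    + (2 ^ M) ℤ.* H ℤ.+ (+ (2 ^ (M ∸ 1)) - + 1)
      ≡⟨ cong (λ M → + (2 ^ M) ℤ.* H ℤ.+ (+ (2 ^ (M ∸ 1)) - + 1)) M≡ ⟩
    + (2 * 2 ^ k) ℤ.* H ℤ.+ (+ (2 ^ k) - + 1)
      ≡⟨ cong (λ x → x ℤ.* H ℤ.+ (+ (2 ^ k) - + 1)) (ℤ.pos-* 2 (2 ^ k)) ⟩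
    + 2 ℤ.* + (2 ^ k) ℤ.* H ℤ.+ (+ (2 ^ k) - + 1)
      ≡⟨ regroup (+ (2 ^ k)) H ⟩
    + (2 ^ k) ℤ.* (+ 2 ℤ.* H ℤ.+ + 1) - + 1 ∎
    where
    open ≡-Reasoning
    Q = pre m (suc i)
    M = m (2 + i)
    H = closedForm m (suc i)
    F₁ F₂ : ℕ → ℤ
    F₁ j = + (2 ^ ((Q ∸ pre m j) ∸ 1)) - + (2 ^ (Q ∸ pre m (suc j)))
    F₂ j = + (2 ^ ((Q + M ∸ pre m j) ∸ 1)) - + (2 ^ (Q + M ∸ pre m (suc j)))
    scaled : ∀ j → 1 ≤ j → j ≤ i → F₂ j ≡ + (2 ^ M) ℤ.* F₁ j
    scaled j 1≤j j≤i = term-scale Q M (pre m j) (pre m (suc j)) (pre-< nonempty 1≤j j≤i) (pre-mono (s≤s j≤i))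
    last : F₂ (suc i) ≡ + (2 ^ (M ∸ 1)) - + 1
    last rewrite m+n∸m≡n Q M | n∸n≡0 (Q + M) = refl
    regroup : ∀ x h → + 2 ℤ.* x ℤ.* h ℤ.+ (x - + 1) ≡ x ℤ.* (+ 2 ℤ.* h ℤ.+ + 1) - + 1
    regroup = ℤ-Solver.solve-∀

  closedForm-singletons : ∀ i → BlocksNonempty m (suc i) → pre m (suc i) ≡ i → closedForm m (suc i) ≡ + 0
  closedForm-singletons zero    nonempty pre≡ = refl
  closedForm-singletons (suc i) nonempty pre≡
    with tight-sum (pre-≥ i (nonempty-pred nonempty)) (nonempty (2 + i) (s≤s (s≤s z≤n)) ≤-refl) pre≡
  ... | pre≡i , M≡1 = begin
    closedForm m (2 + i)                                        ≡⟨ closedForm-step i (nonempty-pred nonempty) M≡1 ⟩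
    + 1 ℤ.* (+ 2 ℤ.* closedForm m (suc i) ℤ.+ + 1) - + 1
      ≡⟨ cong (λ h → + 1 ℤ.* (+ 2 ℤ.* h ℤ.+ + 1) - + 1)
              (closedForm-singletons i (nonempty-pred nonempty) pre≡i) ⟩
    + 0                                                         ∎
    where open ≡-Reasoning

isolate : ∀ x l f w h → x + l ≡ w * l + f → + l ≡ + 2 ℤ.* h ℤ.+ + 1 → + f ≡ + 2 ℤ.* h →
  + x ≡ + w ℤ.* (+ 2 ℤ.* h ℤ.+ + 1) - + 1
isolate x l f w h x+l≡ l≡ f≡ = begin
  + x                                        ≡⟨ add-sub (+ x) (+ l) ⟩
  (+ x ℤ.+ + l) - + l                        ≡⟨ cong (_- + l) (sym (ℤ.pos-+ x l)) ⟩
  + (x + l) - + l                            ≡⟨ cong (λ y → + y - + l) x+l≡ ⟩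
  + (w * l + f) - + l
    ≡⟨ cong (_- + l) (trans (ℤ.pos-+ (w * l) f) (cong (ℤ._+ + f) (ℤ.pos-* w l))) ⟩
  + w ℤ.* + l ℤ.+ + f - + l                  ≡⟨ cong₂ (λ l′ f′ → + w ℤ.* l′ ℤ.+ f′ - l′) l≡ f≡ ⟩
  + w ℤ.* (+ 2 ℤ.* h ℤ.+ + 1) ℤ.+ + 2 ℤ.* h - (+ 2 ℤ.* h ℤ.+ + 1) ≡⟨ cancel (+ w) h ⟩
  + w ℤ.* (+ 2 ℤ.* h ℤ.+ + 1) - + 1          ∎
  where
  open ≡-Reasoning
  add-sub : ∀ x l → x ≡ (x ℤ.+ l) - l
  add-sub = ℤ-Solver.solve-∀
  cancel : ∀ w h →
    w ℤ.* (+ 2 ℤ.* h ℤ.+ + 1) ℤ.+ + 2 ℤ.* h - (+ 2 ℤ.* h ℤ.+ + 1) ≡ w ℤ.* (+ 2 ℤ.* h ℤ.+ + 1) - + 1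
  cancel = ℤ-Solver.solve-∀

remove-spot-and-car : ∀ c i p {M k} → M ≡ suc k → c + suc (suc i) ≡ p + M → c + suc i ≡ p + k
remove-spot-and-car c i p {k = k} refl spots≡cars =
  suc-injective (trans (sym (+-suc c (suc i))) (trans spots≡cars (+-suc p k)))

module Counts (n : ℕ) (m : ℕ → ℕ) where

  H : ℕ → ℤ
  H i = closedForm m (suc i)

  ValueAtRunStart ValueBeforeRun : ℕ → Set
  ValueAtRunStart i = ∀ b c → i + suc b + c ≤ n → c + i ≡ pre m (suc i) →
    + ways n (lot i (suc b) c) (blocks m (suc i)) ≡ + 2 ℤ.* H i ℤ.+ + 1
  ValueBeforeRun i = ∀ b c → suc i + b + c ≤ n → c + suc i ≡ pre m (suc i) →
    + ways n (lot (suc i) b c) (blocks m (suc i)) ≡ + 2 ℤ.* H i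

  block-value : ∀ i → BlocksNonempty m (suc i) → ValueAtRunStart i → ValueBeforeRun i →
    ∀ k b c → suc i + suc b + c ≤ n → c + suc i ≡ pre m (suc i) + k →
    + ways n (lot (suc i) (suc b) c) (replicate k (2 + i) ++ blocks m (suc i))
    ≡ + (2 ^ k) ℤ.* (+ 2 ℤ.* H i ℤ.+ + 1) - + 1
  block-value i nonempty atRunStart beforeRun k b c fits cars≡ =
    let e , i+e≡ = m≤n⇒∃[o]m+o≡n (pre-≥ i nonempty) in with-left-gap e i+e≡
    where
    rs = blocks m (suc i)
    B = suc (k + b)
    b+c≤n : b + c ≤ n
    b+c≤n = ≤-trans (n≤1+n (b + c)) (≤-trans (m≤n+m (suc b + c) (suc i))
                    (≤-trans (≤-reflexive (sym (+-assoc (suc i) (suc b) c))) fits))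

    allForward : ∀ e → i + e ≡ pre m (suc i) → i + B + e ≤ n → + waysIfRoom n (suc i) B e rs ≡ + 2 ℤ.* H i
    -- The right gap overflows only when every lower block is a singleton, and then h = 0.
    allForward zero    i+0≡ _    =
      cong (+ 2 ℤ.*_) (sym (closedForm-singletons i nonempty (trans (sym i+0≡) (+-identityʳ i))))
    allForward (suc e) i+e≡ fits′ =
      beforeRun B e (subst (_≤ n) (shift i B e) fits′) (trans (swap e i) i+e≡)
      where
      shift : ∀ i B e → i + B + suc e ≡ suc i + B + e
      shift = ℕ-Solver.solve-∀
      swap : ∀ e i → e + suc i ≡ i + suc e
      swap = ℕ-Solver.solve-∀

    with-left-gap : ∀ e → i + e ≡ pre m (suc i) →
      + ways n (lot (suc i) (suc b) c) (replicate k (2 + i) ++ rs) ≡ + (2 ^ k) ℤ.* (+ 2 ℤ.* H i ℤ.+ + 1) - + 1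
    with-left-gap e i+e≡ = isolate _ _ _ (2 ^ k) (H i)
      (ways-block n k i b c e rs k+e≡ b+c≤n)
      (atRunStart (k + b) e size-fits (trans (+-comm e i) i+e≡))
      (allForward e i+e≡ size-fits)
      where
      open ≡-Reasoning
      k+e≡ : k + e ≡ suc c
      k+e≡ = +-cancelʳ-≡ i (k + e) (suc c) (begin
        k + e + i         ≡⟨ reorder k e i ⟩
        i + e + k         ≡⟨ cong (_+ k) i+e≡ ⟩
        pre m (suc i) + k ≡⟨ sym cars≡ ⟩
        c + suc i         ≡⟨ +-suc c i ⟩
        suc c + i         ∎)
        where
        reorder : ∀ k e i → k + e + i ≡ i + e + k
        reorder = ℕ-Solver.solve-∀
      size-fits : i + B + e ≤ n
      size-fits = subst (_≤ n) (sym (begin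
        i + B + e           ≡⟨ regroup i k b e ⟩
        i + suc b + (k + e) ≡⟨ cong (_+_ (i + suc b)) k+e≡ ⟩
        i + suc b + suc c   ≡⟨ +-suc (i + suc b) c ⟩
        suc i + suc b + c   ∎)) fits
        where
        regroup : ∀ i k b e → i + suc (k + b) + e ≡ i + suc b + (k + e)
        regroup = ℕ-Solver.solve-∀

  values : ∀ i → BlocksNonempty m (suc i) → ValueAtRunStart i × ValueBeforeRun i
  values zero    _ = (λ _ _ _ _ → refl) , λ b c _ c+1≡0 → contradiction (trans (sym (+-suc c 0)) c+1≡0) λ ()
  values (suc i) nonempty with top-block i nonempty
  ... | k , M≡ = atRunStart , beforeRun
    where
    open ≡-Reasoning
    below = nonempty-pred nonempty
    block = block-value i below (proj₁ (values i below)) (proj₂ (values i below))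
    next-closedForm : + (2 ^ k) ℤ.* (+ 2 ℤ.* H i ℤ.+ + 1) - + 1 ≡ H (suc i)
    next-closedForm = sym (closedForm-step i below M≡)

    atRunStart : ValueAtRunStart (suc i)
    atRunStart b c fits cars≡ = begin
      + ways n (lot (suc i) (suc b) c) (blocks m (2 + i))     ≡⟨ block (m (2 + i)) b c fits cars≡ ⟩
      + (2 ^ m (2 + i)) ℤ.* X - + 1                          ≡⟨ cong (λ M → + (2 ^ M) ℤ.* X - + 1) M≡ ⟩
      + (2 * 2 ^ k) ℤ.* X - + 1                              ≡⟨ cong (λ y → y ℤ.* X - + 1) (ℤ.pos-* 2 (2 ^ k)) ⟩
      + 2 ℤ.* + (2 ^ k) ℤ.* X - + 1                          ≡⟨ double-odd (+ (2 ^ k)) X ⟩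
      + 2 ℤ.* (+ (2 ^ k) ℤ.* X - + 1) ℤ.+ + 1                ≡⟨ cong (λ h → + 2 ℤ.* h ℤ.+ + 1) next-closedForm ⟩
      + 2 ℤ.* H (suc i) ℤ.+ + 1                              ∎
      where
      X = + 2 ℤ.* H i ℤ.+ + 1
      double-odd : ∀ p x → + 2 ℤ.* p ℤ.* x - + 1 ≡ + 2 ℤ.* (p ℤ.* x - + 1) ℤ.+ + 1
      double-odd = ℤ-Solver.solve-∀

    beforeRun : ValueBeforeRun (suc i)
    beforeRun b c fits cars≡ = begin
      + ways n os (blocks m (2 + i))     ≡⟨ cong (λ cs → + ways n os cs) (blocks-top i M≡) ⟩
      + ways n os (2 + i ∷ cs)
        ≡⟨ cong +_ (trans (ways-∷ n os (2 + i) cs) (cong₂ _+_ (parks-at-gap true) (parks-at-gap false))) ⟩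
      + (W + W)                          ≡⟨ ℤ.pos-+ W W ⟩
      + W ℤ.+ + W
        ≡⟨ cong (λ w → w ℤ.+ w) (trans (block k b c fits′ cars≡′) next-closedForm) ⟩
      H (suc i) ℤ.+ H (suc i)            ≡⟨ double (H (suc i)) ⟩
      + 2 ℤ.* H (suc i)                  ∎
      where
      os = lot (2 + i) b c
      cs = replicate k (2 + i) ++ blocks m (suc i)
      W = ways n (lot (suc i) (suc b) c) cs
      parks-at-gap : ∀ x → afterPark n os (2 + i) cs x ≡ W
      parks-at-gap x = afterPark-moves n os (2 + i) cs x (parkOne-gap n (suc i) b c x) (fill-gap (suc i) b c)
      fits′ : suc i + suc b + c ≤ n
      fits′ = subst (_≤ n) (cong (_+ c) (sym (+-suc (suc i) b))) fits
      cars≡′ : c + suc i ≡ pre m (suc i) + k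
      cars≡′ = remove-spot-and-car c i (pre m (suc i)) M≡ cars≡
      double : ∀ h → h ℤ.+ h ≡ + 2 ℤ.* h
      double = ℤ-Solver.solve-∀

lemma9 : (t : ℕ) (m : ℕ → ℕ) → 2 ≤ t →
    (∀ j → 2 ≤ j → j ≤ t → 1 ≤ m j) →
    t ≤ pre m t →
    let n = pre m t
        R = λ j → n ∸ pre m j
    in + g n (blocks m t)
       ≡ sumFrom1 (t ∸ 1) (λ j → + (2 ^ (R j ∸ 1)) - + (2 ^ R (suc j)))
lemma9 (suc (suc i)) m (s≤s (s≤s z≤n)) nonempty t≤n with top-block i nonempty
... | k , M≡ = begin
  + g n (blocks m t)                                          ≡⟨ cong +_ (g-blocks i M≡ t≤n) ⟩
  + ways n (lot (suc i) 1 c) (replicate k t ++ blocks m (suc i))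
    ≡⟨ block-value i below (proj₁ (values i below)) (proj₂ (values i below)) k 0 c fits cars≡ ⟩
  + (2 ^ k) ℤ.* (+ 2 ℤ.* closedForm m (suc i) ℤ.+ + 1) - + 1 ≡⟨ sym (closedForm-step i below M≡) ⟩
  closedForm m t                                              ∎
  where
  open ≡-Reasoning
  open Counts (pre m (2 + i)) m
  t = 2 + i
  n = pre m t
  c = n ∸ t
  below = nonempty-pred nonempty
  t+c≡n : t + c ≡ n
  t+c≡n = m+[n∸m]≡n t≤n
  fits : suc i + 1 + c ≤ n
  fits = ≤-reflexive (trans (cong (_+ c) (+-comm (suc i) 1)) t+c≡n)
  cars≡ : c + suc i ≡ pre m (suc i) + k
  cars≡ = remove-spot-and-car c i (pre m (suc i)) M≡ (trans (+-comm c t) t+c≡n)
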